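{- Let $\mathbf{M}$ be a nonsingular $n\times n$ integer matrix and let $A\subseteq \mathbb{Z}^n/\mathbf{M}\mathbb{Z}^n$. Let $\mathbf{H}=\mathbf{M}\mathbf{V}$ ($\mathbf{V}$ unimodular) be the Hermite normal form of $\mathbf{M}$, and let $\mathbf{S}=\mathrm{diag}(s_1,\dots,s_n)=\mathbf{U}\mathbf{M}\mathbf{V}'$ (with $\mathbf{U},\mathbf{V}'$ unimodular integer matrices) be the Smith normal form of $\mathbf{M}$. Let $r$ be the number of indices $i$ with $s_i\neq 1$, so that $s_1=\dots=s_{n-r}=1$ and $s_{n-r+1},\dots,s_n>1$. Let $\mathbf{S}'=\mathrm{diag}(s_{n-r+1},\dots,s_n)$ and let $\mathbf{U}'$ be the $r\times n$ matrix formed by the last $r$ rows of $\mathbf{U}$. Put $\phi(A)=\{\mathbf{U}'\mathbf{a} : \mathbf{a}\in A\}$ (taken modulo $\mathbf{S}'$). Then the multidimensional circulants $G(\mathbf{M};A)$, $G(\mathbf{H};A)$ and $G(\mathbf{S}';\phi(A))$ are pairwise Ádám isomorphic. (This holds both for digraphs, and for graphs when $A=-A$.)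
   Context: For a nonsingular $\mathbf{M}\in\mathbb{Z}^{n\times n}$, vectors $\mathbf{a},\mathbf{b}\in\mathbb{Z}^n$ are congruent modulo $\mathbf{M}$ if $\mathbf{a}-\mathbf{b}\in\mathbf{M}\mathbb{Z}^n$ (the lattice spanned by the columns of $\mathbf{M}$); $\mathbb{Z}^n/\mathbf{M}\mathbb{Z}^n$ is the resulting finite abelian group. Note $\mathbf{M}\mathbb{Z}^n=\mathbf{H}\mathbb{Z}^n$, so $A$ is also a subset of $\mathbb{Z}^n/\mathbf{H}\mathbb{Z}^n$. For $A\subseteq\mathbb{Z}^n/\mathbf{M}\mathbb{Z}^n$, the multidimensional circulant digraph $G(\mathbf{M};A)$ has vertex set $\mathbb{Z}^n/\mathbf{M}\mathbb{Z}^n$ and an arc from $\mathbf{u}$ to $\mathbf{u}+\mathbf{a} \pmod{\mathbf{M}}$ for each $\mathbf{a}\in A$; when $A=-A$ it is regarded as a graph (multidimensional circulant graph). The Hermite normal form of $\mathbf{M}$ is the unique upper triangular matrix $\mathbf{H}=\mathbf{M}\mathbf{V}$, $\mathbf{V}$ unimodular, with positive diagonal entries and with each entry above the diagonal in $\{0,\dots,h_{ii}-1\}$. The Smith normal form is the unique diagonal matrix $\mathrm{diag}(s_1,\dots,s_n)$ equivalent to $\mathbf{M}$ (i.e. $=\mathbf{U}\mathbf{M}\mathbf{V}'$ with $\mathbf{U},\mathbf{V}'$ unimodular) with positive $s_i$ and $s_i\mid s_{i+1}$. Two multidimensional circulants $G(\mathbf{M};A)$ and $G(\mathbf{M}';A')$,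 with $\mathbf{M}\in\mathbb{Z}^{n\times n}$, $\mathbf{M}'\in\mathbb{Z}^{n'\times n'}$, are Ádám isomorphic if there is a group isomorphism $\psi:\mathbb{Z}^n/\mathbf{M}\mathbb{Z}^n\to\mathbb{Z}^{n'}/\mathbf{M}'\mathbb{Z}^{n'}$ with $\psi(A)=A'$. -}

module Defs where

open import Data.Nat as ℕ using (ℕ; zero; suc; _∸_; _<_)
open import Data.Nat.Divisibility using (_∣_)
open import Data.Nat.Properties using (m∸n+n≡m; ≤-refl)
open import Data.Integer as ℤ using (ℤ; +_; -_; _+_; _-_; _*_; 0ℤ; 1ℤ)
open import Data.Fin as Fin using (Fin; zero; suc; toℕ; punchIn; _↑ʳ_; cast)
open import Data.Fin.Properties using ()
open import Data.Product using (Σ; ∃; _×_; _,_)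
open import Data.Sum using (_⊎_)
open import Relation.Nullary using (¬_; yes; no)
open import Relation.Binary.PropositionalEquality using (_≡_; _≢_)

Vec : ℕ → Set
Vec n = Fin n → ℤ

Mat : ℕ → ℕ → Set
Mat m n = Fin m → Fin n → ℤ

Σᶠ : ∀ {n} → (Fin n → ℤ) → ℤ
Σᶠ {zero}  f = 0ℤ
Σᶠ {suc n} f = f zero + Σᶠ (λ i → f (suc i))

_·_ : ∀ {m k n} → Mat m k → Mat k n → Mat m n
(A · B) i j = Σᶠ (λ l → A i l * B l j)

_*ᵥ_ : ∀ {m n} → Mat m n → Vec n → Vec m
(A *ᵥ x) i = Σᶠ (λ l → A i l * x l)

_+ᵥ_ : ∀ {n} → Vec n → Vec n → Vec n
(a +ᵥ b) i = a i + b i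

sgn : ℕ → ℤ
sgn zero = 1ℤ
sgn (suc k) = - sgn k

det : ∀ {n} → Mat n n → ℤ
det {zero}  M = 1ℤ
det {suc n} M = Σᶠ (λ j → sgn (toℕ j) * (M zero j * det (λ i k → M (suc i) (punchIn j k))))

Nonsingular : ∀ {n} → Mat n n → Set
Nonsingular M = det M ≢ 0ℤ

Unimodular : ∀ {n} → Mat n n → Set
Unimodular V = (det V ≡ 1ℤ) ⊎ (det V ≡ - 1ℤ)

IsHermiteNF : ∀ {n} → Mat n n → Set
IsHermiteNF {n} H =
  (∀ (i j : Fin n) → toℕ j < toℕ i → H i j ≡ 0ℤ)
  × (∀ (i : Fin n) → ℤ.0ℤ ℤ.< H i i)
  × (∀ (i j : Fin n) → toℕ i < toℕ j → (0ℤ ℤ.≤ H i j) × (H i j ℤ.< H i i))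

diag : ∀ {n} → (Fin n → ℕ) → Mat n n
diag s i j with i Fin.≟ j
... | yes _ = + s i
... | no  _ = 0ℤ

_≡_[mod_] : ∀ {n} → Vec n → Vec n → Mat n n → Set
_≡_[mod_] {n} a b M = ∃ λ (x : Vec n) → ∀ i → a i - b i ≡ (M *ᵥ x) i

-- a subset A of ℤ^n / M ℤ^n, represented by a predicate on ℤ^n closed under congruence
IsSubsetMod : ∀ {n} → Mat n n → (Vec n → Set) → Set
IsSubsetMod {n} M A = ∀ (a b : Vec n) → a ≡ b [mod M ] → A a → A b

-- Ádám isomorphism of G(M;A) and G(M';A'): a group isomorphism
-- ψ : ℤ^n/Mℤ^n → ℤ^n'/M'ℤ^n' (given by a lift to representatives) with ψ(A) = A'
record AdamIsomorphic {n n'} (M : Mat n n) (A : Vec n → Set)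
                      (M' : Mat n' n') (A' : Vec n' → Set) : Set where
  field
    ψ          : Vec n → Vec n'
    well-def   : ∀ a b → a ≡ b [mod M ] → ψ a ≡ ψ b [mod M' ]
    additive   : ∀ a b → ψ (a +ᵥ b) ≡ (ψ a +ᵥ ψ b) [mod M' ]
    injective  : ∀ a b → ψ a ≡ ψ b [mod M' ] → a ≡ b [mod M ]
    surjective : ∀ b → ∃ λ a → ψ a ≡ b [mod M' ]
    image⊆     : ∀ a → A a → A' (ψ a)
    image⊇     : ∀ b → A' b → ∃ λ a → A a × (ψ a ≡ b [mod M' ])

countNon1 : ∀ {n} → (Fin n → ℕ) → ℕ
countNon1 {zero}  s = zero
countNon1 {suc n} s with s zero ℕ.≟ 1
... | yes _ = countNon1 (λ i → s (suc i))
... | no  _ = suc (countNon1 (λ i → s (suc i)))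

countNon1≤ : ∀ {n} (s : Fin n → ℕ) → countNon1 s ℕ.≤ n
countNon1≤ {zero}  s = ℕ.z≤n
countNon1≤ {suc n} s with s zero ℕ.≟ 1
... | yes _ = Data.Nat.Properties.m≤n⇒m≤1+n (countNon1≤ (λ i → s (suc i)))
  where import Data.Nat.Properties
... | no  _ = ℕ.s≤s (countNon1≤ (λ i → s (suc i)))

lastIdx : ∀ {n r} → r ℕ.≤ n → Fin r → Fin n
lastIdx {n} {r} r≤n i = cast (m∸n+n≡m r≤n) ((n ∸ r) ↑ʳ i)

rOf : ∀ {n} → (Fin n → ℕ) → ℕ
rOf = countNon1

S′ : ∀ {n} (s : Fin n → ℕ) → Mat (rOf s) (rOf s)
S′ s = diag (λ i → s (lastIdx (countNon1≤ s) i))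

U′ : ∀ {n} (s : Fin n → ℕ) → Mat n n → Mat (rOf s) n
U′ s U i j = U (lastIdx (countNon1≤ s) i) j

φ : ∀ {n} (s : Fin n → ℕ) → Mat n n → (Vec n → Set) → Vec (rOf s) → Set
φ s U A b = ∃ λ a → A a × (b ≡ (U′ s U *ᵥ a) [mod S′ s ])

IsSmithNF : ∀ {n} → Mat n n → Mat n n → Mat n n → (Fin n → ℕ) → Set
IsSmithNF {n} M U V′ s =
  Unimodular U × Unimodular V′
  × (∀ i j → ((U · M) · V′) i j ≡ diag s i j)
  × (∀ i → 0 < s i)
  × (∀ (i j : Fin n) → toℕ j ≡ suc (toℕ i) → s i ∣ s j)

-- Each of the isomorphisms is induced by an integer matrix (the identity, resp. U′),
-- and such a map is an Ádám isomorphism as soon as it is onto and both preserves and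
-- reflects congruence, so everything reduces to comparing congruences.  Since M V = H
-- with V invertible over ℤ, M and H span the same lattice and the identity map already
-- works.  For the Smith form, a ↦ U a carries congruence mod M to congruence mod
-- U M V′ = diag(s); as the divisibility chain forces the leading s_i to be 1, those
-- coordinates carry no information and projecting to the last r coordinates is an
-- isomorphism onto ℤ^r / S′ℤ^r.  Invertibility of unimodular matrices comes from the
-- adjugate identity A · adj A = det A · I, proved from Laplace expansion.
module Submission where

open import Defs
open import Data.Nat as ℕ using (ℕ; zero; suc; _∸_; _<_)
import Data.Nat.Properties as ℕP
open import Data.Nat.Divisibility using (_∣_; ∣1⇒≡1)
open import Data.Integer as ℤ using (ℤ; +_; -_; _+_; _-_; _*_; 0ℤ; 1ℤ)
import Data.Integer.Properties as ℤP
open import Data.Integer.Tactic.RingSolver using (solve-∀)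
open import Data.Fin as Fin using (Fin; zero; suc; toℕ; punchIn; punchOut; cast; splitAt; join; _↑ʳ_)
import Data.Fin.Properties as FinP
open import Data.Product using (∃; _×_; _,_)
open import Data.Sum using (_⊎_; inj₁; inj₂; [_,_]′)
open import Data.Empty using (⊥-elim)
open import Function.Base using (_∘_; flip)
open import Function.Bundles using (_⇔_; mk⇔; Equivalence)
open import Function.Construct.Composition using (_⇔-∘_)
open import Function.Construct.Symmetry using (⇔-sym)
open import Function.Properties.Equivalence using (⇔-setoid)
open import Level using (0ℓ)
open import Relation.Nullary using (yes; no)
open import Relation.Binary.PropositionalEquality
import Relation.Binary.Reasoning.Setoid as SetoidReasoning
open import Algebra.Properties.Semiring.Sum ℤP.+-*-semiring
  using (sum; ∑-distrib-+; ∑-comm; *-distribˡ-sum; *-distribʳ-sum)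
open ≡-Reasoning

-- Finite sums and matrix–vector products

Σᶠ≡sum : ∀ {n} (f : Fin n → ℤ) → Σᶠ f ≡ sum f
Σᶠ≡sum {zero}  f = refl
Σᶠ≡sum {suc n} f = cong (λ t → f zero + t) (Σᶠ≡sum (f ∘ suc))

Σᶠ-cong : ∀ {n} {f g : Fin n → ℤ} → f ≗ g → Σᶠ f ≡ Σᶠ g
Σᶠ-cong {zero}  f≗g = refl
Σᶠ-cong {suc n} f≗g = cong₂ _+_ (f≗g zero) (Σᶠ-cong (f≗g ∘ suc))

Σᶠ-zero : ∀ {n} {f : Fin n → ℤ} → (∀ i → f i ≡ 0ℤ) → Σᶠ f ≡ 0ℤ
Σᶠ-zero {zero}  f≡0 = refl
Σᶠ-zero {suc n} f≡0 = cong₂ _+_ (f≡0 zero) (Σᶠ-zero (f≡0 ∘ suc))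

Σᶠ-single : ∀ {n} (f : Fin n → ℤ) (k : Fin n) → (∀ i → i ≢ k → f i ≡ 0ℤ) → Σᶠ f ≡ f k
Σᶠ-single {suc n} f zero    f≡0 =
  trans (cong (λ t → f zero + t) (Σᶠ-zero (λ i → f≡0 (suc i) λ ()))) (ℤP.+-identityʳ (f zero))
Σᶠ-single {suc n} f (suc k) f≡0 = trans
  (cong₂ _+_ (f≡0 zero λ ()) (Σᶠ-single (f ∘ suc) k λ i i≢k → f≡0 (suc i) (i≢k ∘ FinP.suc-injective)))
  (ℤP.+-identityˡ (f (suc k)))

Σᶠ-distrib-+ : ∀ {n} (f g : Fin n → ℤ) → Σᶠ (λ i → f i + g i) ≡ Σᶠ f + Σᶠ g
Σᶠ-distrib-+ f g = begin
  Σᶠ (λ i → f i + g i)  ≡⟨ Σᶠ≡sum (λ i → f i + g i) ⟩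
  sum (λ i → f i + g i) ≡⟨ ∑-distrib-+ f g ⟩
  sum f + sum g         ≡⟨ cong₂ _+_ (Σᶠ≡sum f) (Σᶠ≡sum g) ⟨
  Σᶠ f + Σᶠ g           ∎

Σᶠ-*ˡ : ∀ {n} (c : ℤ) (f : Fin n → ℤ) → Σᶠ (λ i → c * f i) ≡ c * Σᶠ f
Σᶠ-*ˡ c f = begin
  Σᶠ (λ i → c * f i)  ≡⟨ Σᶠ≡sum (λ i → c * f i) ⟩
  sum (λ i → c * f i) ≡⟨ *-distribˡ-sum c f ⟨
  c * sum f           ≡⟨ cong (c *_) (Σᶠ≡sum f) ⟨
  c * Σᶠ f            ∎

Σᶠ-*ʳ : ∀ {n} (c : ℤ) (f : Fin n → ℤ) → Σᶠ (λ i → f i * c) ≡ Σᶠ f * c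
Σᶠ-*ʳ c f = begin
  Σᶠ (λ i → f i * c)  ≡⟨ Σᶠ≡sum (λ i → f i * c) ⟩
  sum (λ i → f i * c) ≡⟨ *-distribʳ-sum c f ⟨
  sum f * c           ≡⟨ cong (_* c) (Σᶠ≡sum f) ⟨
  Σᶠ f * c            ∎

Σᶠ-neg : ∀ {n} (f : Fin n → ℤ) → Σᶠ (λ i → - f i) ≡ - Σᶠ f
Σᶠ-neg f = begin
  Σᶠ (λ i → - f i)      ≡⟨ Σᶠ-cong (λ i → ℤP.-1*i≡-i (f i)) ⟨
  Σᶠ (λ i → - 1ℤ * f i) ≡⟨ Σᶠ-*ˡ (- 1ℤ) f ⟩
  - 1ℤ * Σᶠ f           ≡⟨ ℤP.-1*i≡-i (Σᶠ f) ⟩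
  - Σᶠ f                ∎

Σᶠ-comm : ∀ {m n} (f : Fin m → Fin n → ℤ) →
  Σᶠ (λ i → Σᶠ (f i)) ≡ Σᶠ (λ j → Σᶠ (λ i → f i j))
Σᶠ-comm f = begin
  Σᶠ (λ i → Σᶠ (f i))           ≡⟨ Σ²≡sum² f ⟩
  sum (λ i → sum (f i))         ≡⟨ ∑-comm f ⟩
  sum (λ j → sum (λ i → f i j)) ≡⟨ Σ²≡sum² (flip f) ⟨
  Σᶠ (λ j → Σᶠ (λ i → f i j))   ∎
  where
  Σ²≡sum² : ∀ {m n} (g : Fin m → Fin n → ℤ) → Σᶠ (λ i → Σᶠ (g i)) ≡ sum (λ i → sum (g i))
  Σ²≡sum² g = trans (Σᶠ-cong (Σᶠ≡sum ∘ g)) (Σᶠ≡sum (λ i → sum (g i)))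

infix 4 _≐_

_≐_ : ∀ {m n} → Mat m n → Mat m n → Set
A ≐ B = ∀ i j → A i j ≡ B i j

Iₘ : ∀ {n} → Mat n n
Iₘ = diag (λ _ → 1)

_ᵀ : ∀ {m n} → Mat m n → Mat n m
(A ᵀ) i j = A j i

*ᵥ-congˡ : ∀ {m n} {A B : Mat m n} → A ≐ B → ∀ x → A *ᵥ x ≗ B *ᵥ x
*ᵥ-congˡ A≐B x i = Σᶠ-cong (λ l → cong (_* x l) (A≐B i l))

*ᵥ-congʳ : ∀ {m n} (A : Mat m n) {x y : Vec n} → x ≗ y → A *ᵥ x ≗ A *ᵥ y
*ᵥ-congʳ A x≗y i = Σᶠ-cong (λ l → cong (A i l *_) (x≗y l))

*ᵥ-zeroʳ : ∀ {m n} (A : Mat m n) → A *ᵥ (λ _ → 0ℤ) ≗ λ _ → 0ℤ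
*ᵥ-zeroʳ A i = Σᶠ-zero (λ l → ℤP.*-zeroʳ (A i l))

*ᵥ-neg : ∀ {m n} (A : Mat m n) (x : Vec n) → A *ᵥ (-_ ∘ x) ≗ -_ ∘ (A *ᵥ x)
*ᵥ-neg A x i = trans (Σᶠ-cong (λ l → sym (ℤP.neg-distribʳ-* (A i l) (x l)))) (Σᶠ-neg (λ l → A i l * x l))

*ᵥ-distrib-+ : ∀ {m n} (A : Mat m n) (x y : Vec n) → A *ᵥ (x +ᵥ y) ≗ (A *ᵥ x) +ᵥ (A *ᵥ y)
*ᵥ-distrib-+ A x y i = trans (Σᶠ-cong (λ l → ℤP.*-distribˡ-+ (A i l) (x l) (y l)))
  (Σᶠ-distrib-+ (λ l → A i l * x l) (λ l → A i l * y l))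

*ᵥ-distrib-- : ∀ {m n} (A : Mat m n) (x y : Vec n) → A *ᵥ (λ j → x j - y j) ≗ λ i → (A *ᵥ x) i - (A *ᵥ y) i
*ᵥ-distrib-- A x y i = trans (*ᵥ-distrib-+ A x (-_ ∘ y) i) (cong (λ t → (A *ᵥ x) i + t) (*ᵥ-neg A y i))

·-*ᵥ-assoc : ∀ {m k n} (A : Mat m k) (B : Mat k n) (x : Vec n) → (A · B) *ᵥ x ≗ A *ᵥ (B *ᵥ x)
·-*ᵥ-assoc A B x i = begin
  Σᶠ (λ j → Σᶠ (λ l → A i l * B l j) * x j)
    ≡⟨ Σᶠ-cong (λ j → Σᶠ-*ʳ (x j) (λ l → A i l * B l j)) ⟨
  Σᶠ (λ j → Σᶠ (λ l → A i l * B l j * x j))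
    ≡⟨ Σᶠ-comm (λ j l → A i l * B l j * x j) ⟩
  Σᶠ (λ l → Σᶠ (λ j → A i l * B l j * x j))
    ≡⟨ Σᶠ-cong (λ l → Σᶠ-cong (λ j → ℤP.*-assoc (A i l) (B l j) (x j))) ⟩
  Σᶠ (λ l → Σᶠ (λ j → A i l * (B l j * x j)))
    ≡⟨ Σᶠ-cong (λ l → Σᶠ-*ˡ (A i l) (λ j → B l j * x j)) ⟩
  Σᶠ (λ l → A i l * Σᶠ (λ j → B l j * x j)) ∎

diag-diagonal : ∀ {n} (t : Fin n → ℕ) i → diag t i i ≡ + t i
diag-diagonal t i with i Fin.≟ i
... | yes _  = refl
... | no i≢i = ⊥-elim (i≢i refl)

diag-offDiagonal : ∀ {n} (t : Fin n → ℕ) {i j} → i ≢ j → diag t i j ≡ 0ℤ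
diag-offDiagonal t {i} {j} i≢j with i Fin.≟ j
... | yes i≡j = ⊥-elim (i≢j i≡j)
... | no _    = refl

diag-*ᵥ : ∀ {n} (t : Fin n → ℕ) (y : Vec n) → diag t *ᵥ y ≗ λ i → + t i * y i
diag-*ᵥ t y i = trans
  (Σᶠ-single _ i (λ l l≢i → trans (cong (_* y l) (diag-offDiagonal t (l≢i ∘ sym))) (ℤP.*-zeroˡ (y l))))
  (cong (_* y i) (diag-diagonal t i))

Iₘ-*ᵥ : ∀ {n} (y : Vec n) → Iₘ *ᵥ y ≗ y
Iₘ-*ᵥ y i = trans (diag-*ᵥ _ y i) (ℤP.*-identityˡ (y i))

*ᵥ-cancel : ∀ {n} (L U : Mat n n) → L · U ≐ Iₘ → ∀ x → L *ᵥ (U *ᵥ x) ≗ x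
*ᵥ-cancel L U L·U≐I x i = begin
  (L *ᵥ (U *ᵥ x)) i ≡⟨ ·-*ᵥ-assoc L U x i ⟨
  ((L · U) *ᵥ x) i  ≡⟨ *ᵥ-congˡ L·U≐I x i ⟩
  (Iₘ *ᵥ x) i       ≡⟨ Iₘ-*ᵥ x i ⟩
  x i               ∎

Iₘ-symmetric : ∀ {n} → Iₘ {n} ᵀ ≐ Iₘ
Iₘ-symmetric i j with i Fin.≟ j | j Fin.≟ i
... | yes _   | yes _   = refl
... | no _    | no _    = refl
... | yes i≡j | no j≢i  = ⊥-elim (j≢i (sym i≡j))
... | no i≢j  | yes j≡i = ⊥-elim (i≢j (sym j≡i))

-- Determinants and the adjugate

sgn-involutive : ∀ k x → sgn k * (sgn k * x) ≡ x
sgn-involutive zero    x = trans (ℤP.*-identityˡ (1ℤ * x)) (ℤP.*-identityˡ x)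
sgn-involutive (suc k) x = trans (negate² (sgn k) x) (sgn-involutive k x)
  where
  negate² : ∀ a b → (- a) * ((- a) * b) ≡ a * (a * b)
  negate² = solve-∀

minor : ∀ {n} → Fin (suc n) → Fin (suc n) → Mat (suc n) (suc n) → Mat n n
minor i j A r c = A (punchIn i r) (punchIn j c)

det-cong : ∀ {n} (A B : Mat n n) → A ≐ B → det A ≡ det B
det-cong {zero}  A B A≐B = refl
det-cong {suc n} A B A≐B = Σᶠ-cong λ j →
  cong₂ (λ a d → sgn (toℕ j) * (a * d)) (A≐B zero j) (det-cong _ _ (λ r c → A≐B (suc r) (punchIn j c)))

-- Expanding along row 0 and then each minor along its column 0 gives a double sum over
-- the entries A 0 (1+j) and A (1+i) 0 that is symmetric in the roles of row 0 and
-- column 0; read the other way round it is the column-0 expansion.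
det-expand-col₀ : ∀ {n} (A : Mat (suc n) (suc n)) →
  det A ≡ Σᶠ (λ i → sgn (toℕ i) * (A i zero * det (minor i zero A)))
det-expand-col₀ {zero}  A = refl
det-expand-col₀ {suc n} A = cong (λ t → sgn 0 * (A zero zero * det (minor zero zero A)) + t) (begin
  Σᶠ (λ j → (- σ j) * (row j * det (minor zero (suc j) A)))
    ≡⟨ Σᶠ-cong (λ j → cong (λ t → (- σ j) * (row j * t)) (det-expand-col₀ (minor zero (suc j) A))) ⟩
  Σᶠ (λ j → (- σ j) * (row j * Σᶠ (λ i → σ i * (col i * d i j))))
    ≡⟨ Σᶠ-cong (λ j → pull (- σ j) (row j) (λ i → σ i * (col i * d i j))) ⟩
  Σᶠ (λ j → Σᶠ (λ i → (- σ j) * (row j * (σ i * (col i * d i j)))))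
    ≡⟨ Σᶠ-comm (λ j i → (- σ j) * (row j * (σ i * (col i * d i j)))) ⟩
  Σᶠ (λ i → Σᶠ (λ j → (- σ j) * (row j * (σ i * (col i * d i j)))))
    ≡⟨ Σᶠ-cong (λ i → Σᶠ-cong (λ j → exchange (σ j) (row j) (σ i) (col i) (d i j))) ⟩
  Σᶠ (λ i → Σᶠ (λ j → (- σ i) * (col i * (σ j * (row j * d i j)))))
    ≡⟨ Σᶠ-cong (λ i → pull (- σ i) (col i) (λ j → σ j * (row j * d i j))) ⟨
  Σᶠ (λ i → (- σ i) * (col i * det (minor (suc i) zero A))) ∎)
  where
  σ : Fin (suc n) → ℤ
  σ i = sgn (toℕ i)
  row col : Fin (suc n) → ℤ
  row j = A zero (suc j)
  col i = A (suc i) zero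
  d : Fin (suc n) → Fin (suc n) → ℤ
  d i j = det (minor i zero (minor zero (suc j) A))
  pull : ∀ {m} x y (g : Fin m → ℤ) → x * (y * Σᶠ g) ≡ Σᶠ (λ i → x * (y * g i))
  pull x y g = sym (trans (Σᶠ-*ˡ x (λ i → y * g i)) (cong (x *_) (Σᶠ-*ˡ y g)))
  exchange : ∀ a b c e u → (- a) * (b * (c * (e * u))) ≡ (- c) * (e * (a * (b * u)))
  exchange = solve-∀

det-ᵀ : ∀ {n} (A : Mat n n) → det (A ᵀ) ≡ det A
det-ᵀ {zero}  A = refl
det-ᵀ {suc n} A = trans
  (Σᶠ-cong (λ j → cong (λ t → sgn (toℕ j) * (A j zero * t)) (det-ᵀ (minor j zero A))))
  (sym (det-expand-col₀ A))

swap₀₁ : ∀ {n} → Fin (suc (suc n)) → Fin (suc (suc n))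
swap₀₁ zero          = suc zero
swap₀₁ (suc zero)    = zero
swap₀₁ (suc (suc i)) = suc (suc i)

-- Expanding along row 0, the terms for columns 0 and 1 trade places with a sign
-- change, and the remaining terms are negated once the claim holds for their minors.
det-swapCols₀₁ : ∀ {n} (A : Mat (suc (suc n)) (suc (suc n))) → det (λ i → A i ∘ swap₀₁) ≡ - det A
det-swapCols₀₁ {n} A = begin
  1ℤ * (A zero (suc zero) * det (λ r c → A (suc r) (swap₀₁ (suc c))))
    + ((- 1ℤ) * (A zero zero * det (λ r c → A (suc r) (swap₀₁ (punchIn (suc zero) c)))) + Σᶠ (rest A′))
    ≡⟨ cong₂ (λ x t → 1ℤ * (A zero (suc zero) * x) + t) minor₀₁
         (cong₂ (λ y z → (- 1ℤ) * (A zero zero * y) + z) minor₀₀ (rest-swapped A)) ⟩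
  1ℤ * (A zero (suc zero) * det (minor zero (suc zero) A))
    + ((- 1ℤ) * (A zero zero * det (minor zero zero A)) + - Σᶠ (rest A))
    ≡⟨ exchange (A zero (suc zero)) (det (minor zero (suc zero) A))
                (A zero zero) (det (minor zero zero A)) (Σᶠ (rest A)) ⟩
  - det A ∎
  where
  A′ : Mat (suc (suc n)) (suc (suc n))
  A′ i = A i ∘ swap₀₁
  term : ∀ {m} (B : Mat (suc (suc m)) (suc (suc m))) → Fin (suc (suc m)) → ℤ
  term B j = sgn (toℕ j) * (B zero j * det (minor zero j B))
  rest : ∀ {m} (B : Mat (suc (suc m)) (suc (suc m))) → Fin m → ℤ
  rest B j = term B (suc (suc j))
  minor₀₁ : det (λ r c → A (suc r) (swap₀₁ (suc c))) ≡ det (minor zero (suc zero) A)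
  minor₀₁ = det-cong (λ r c → A (suc r) (swap₀₁ (suc c))) (minor zero (suc zero) A)
    λ { r zero → refl ; r (suc c) → refl }
  minor₀₀ : det (λ r c → A (suc r) (swap₀₁ (punchIn (suc zero) c))) ≡ det (minor zero zero A)
  minor₀₀ = det-cong (λ r c → A (suc r) (swap₀₁ (punchIn (suc zero) c))) (minor zero zero A)
    λ { r zero → refl ; r (suc c) → refl }
  rest-swapped : ∀ {m} (B : Mat (suc (suc m)) (suc (suc m))) →
    Σᶠ (rest (λ i → B i ∘ swap₀₁)) ≡ - Σᶠ (rest B)
  rest-swapped {zero}  B = refl
  rest-swapped {suc m} B = trans (Σᶠ-cong termwise) (Σᶠ-neg (rest B))
    where
    termwise : ∀ j → rest (λ i → B i ∘ swap₀₁) j ≡ - rest B j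
    termwise j = begin
      sgn (toℕ j′) * (B zero j′ * det (λ r c → B (suc r) (swap₀₁ (punchIn j′ c))))
        ≡⟨ cong (λ t → sgn (toℕ j′) * (B zero j′ * t))
             (trans minor-swapped (det-swapCols₀₁ (minor zero j′ B))) ⟩
      sgn (toℕ j′) * (B zero j′ * - det (minor zero j′ B))
        ≡⟨ negate-inner (sgn (toℕ j′)) (B zero j′) (det (minor zero j′ B)) ⟩
      - term B j′ ∎
      where
      j′ : Fin (suc (suc (suc m)))
      j′ = suc (suc j)
      minor-swapped : det (λ r c → B (suc r) (swap₀₁ (punchIn j′ c))) ≡ det (λ r → minor zero j′ B r ∘ swap₀₁)
      minor-swapped = det-cong (λ r c → B (suc r) (swap₀₁ (punchIn j′ c))) (λ r → minor zero j′ B r ∘ swap₀₁)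
        λ { r zero → refl ; r (suc zero) → refl ; r (suc (suc c)) → refl }
      negate-inner : ∀ a b c → a * (b * (- c)) ≡ - (a * (b * c))
      negate-inner = solve-∀
  exchange : ∀ a b c e f →
    1ℤ * (a * b) + ((- 1ℤ) * (c * e) + - f) ≡ - (1ℤ * (c * e) + ((- 1ℤ) * (a * b) + f))
  exchange = solve-∀

det-swapRows₀₁ : ∀ {n} (A : Mat (suc (suc n)) (suc (suc n))) → det (A ∘ swap₀₁) ≡ - det A
det-swapRows₀₁ A = begin
  det (A ∘ swap₀₁)             ≡⟨ det-ᵀ (A ∘ swap₀₁) ⟨
  det (λ i → (A ᵀ) i ∘ swap₀₁) ≡⟨ det-swapCols₀₁ (A ᵀ) ⟩
  - det (A ᵀ)                  ≡⟨ cong -_ (det-ᵀ A) ⟩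
  - det A                      ∎

self-negating : ∀ x → x ≡ - x → x ≡ 0ℤ
self-negating (+ zero)  _  = refl
self-negating (+ suc n) ()
self-negating ℤ.-[1+ n ] ()

det-equalRows₀₁ : ∀ {n} (A : Mat (suc (suc n)) (suc (suc n))) → A zero ≗ A (suc zero) → det A ≡ 0ℤ
det-equalRows₀₁ A A₀≗A₁ =
  self-negating (det A) (trans (det-cong A (A ∘ swap₀₁) A≐A∘swap) (det-swapRows₀₁ A))
  where
  A≐A∘swap : A ≐ A ∘ swap₀₁
  A≐A∘swap zero          = A₀≗A₁
  A≐A∘swap (suc zero)    = sym ∘ A₀≗A₁
  A≐A∘swap (suc (suc r)) = λ _ → refl

toFront : ∀ {n} → Fin (suc n) → Fin (suc n) → Fin (suc n)
toFront k zero    = k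
toFront k (suc r) = punchIn k r

toSecond : ∀ {n} → Fin (suc n) → Fin (suc (suc n)) → Fin (suc (suc n))
toSecond k zero    = zero
toSecond k (suc r) = suc (toFront k r)

-- Moving row k to the front takes k adjacent transpositions.
det-toFront : ∀ {n} (k : Fin (suc n)) (A : Mat (suc n) (suc n)) → det (A ∘ toFront k) ≡ sgn (toℕ k) * det A
det-toSecond : ∀ {n} (k : Fin (suc n)) (A : Mat (suc (suc n)) (suc (suc n))) →
  det (A ∘ toSecond k) ≡ sgn (toℕ k) * det A

det-toFront zero A = trans (det-cong (A ∘ toFront zero) A λ { zero c → refl ; (suc r) c → refl })
  (sym (ℤP.*-identityˡ (det A)))
det-toFront {suc n} (suc k) A = begin
  det (A ∘ toFront (suc k))
    ≡⟨ det-cong (A ∘ toFront (suc k)) (A ∘ toSecond k ∘ swap₀₁)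
         (λ { zero c → refl ; (suc zero) c → refl ; (suc (suc r)) c → refl }) ⟩
  det (A ∘ toSecond k ∘ swap₀₁)
    ≡⟨ det-swapRows₀₁ (A ∘ toSecond k) ⟩
  - det (A ∘ toSecond k)
    ≡⟨ cong -_ (det-toSecond k A) ⟩
  - (sgn (toℕ k) * det A)
    ≡⟨ ℤP.neg-distribˡ-* (sgn (toℕ k)) (det A) ⟩
  sgn (toℕ (suc k)) * det A ∎

det-toSecond k A = begin
  Σᶠ (λ j → sgn (toℕ j) * (A zero j * det (minor zero j A ∘ toFront k)))
    ≡⟨ Σᶠ-cong (λ j → cong (λ t → sgn (toℕ j) * (A zero j * t)) (det-toFront k (minor zero j A))) ⟩
  Σᶠ (λ j → sgn (toℕ j) * (A zero j * (sgn (toℕ k) * det (minor zero j A))))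
    ≡⟨ Σᶠ-cong (λ j → rearrange (sgn (toℕ j)) (A zero j) (sgn (toℕ k)) (det (minor zero j A))) ⟩
  Σᶠ (λ j → sgn (toℕ k) * (sgn (toℕ j) * (A zero j * det (minor zero j A))))
    ≡⟨ Σᶠ-*ˡ (sgn (toℕ k)) (λ j → sgn (toℕ j) * (A zero j * det (minor zero j A))) ⟩
  sgn (toℕ k) * det A ∎
  where
  rearrange : ∀ a b c d → a * (b * (c * d)) ≡ c * (a * (b * d))
  rearrange = solve-∀

sgn*x≡0⇒x≡0 : ∀ k x → sgn k * x ≡ 0ℤ → x ≡ 0ℤ
sgn*x≡0⇒x≡0 k x sgn*x≡0 = begin
  x                   ≡⟨ sgn-involutive k x ⟨
  sgn k * (sgn k * x) ≡⟨ cong (sgn k *_) sgn*x≡0 ⟩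
  sgn k * 0ℤ          ≡⟨ ℤP.*-zeroʳ (sgn k) ⟩
  0ℤ                  ∎

-- Bring row k to the top and then row i to second place; these two rows now agree.
det-equalRows : ∀ {n} (A : Mat n n) {k i : Fin n} → k ≢ i → A k ≗ A i → det A ≡ 0ℤ
det-equalRows {suc zero}    A {zero} {zero} k≢i _ = ⊥-elim (k≢i refl)
det-equalRows {suc (suc n)} A {k}    {i}    k≢i Aₖ≗Aᵢ =
  sgn*x≡0⇒x≡0 (toℕ k) (det A) (trans (sym (det-toFront k A)) det-A′≡0)
  where
  A′ : Mat (suc (suc n)) (suc (suc n))
  A′ = A ∘ toFront k
  i′ : Fin (suc n)
  i′ = punchOut k≢i
  rows₀₁-equal : (A′ ∘ toSecond i′) zero ≗ (A′ ∘ toSecond i′) (suc zero)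
  rows₀₁-equal c = trans (Aₖ≗Aᵢ c) (cong (λ t → A t c) (sym (FinP.punchIn-punchOut k≢i)))
  det-A′≡0 : det A′ ≡ 0ℤ
  det-A′≡0 = sgn*x≡0⇒x≡0 (toℕ i′) (det A′)
    (trans (sym (det-toSecond i′ A′)) (det-equalRows₀₁ (A′ ∘ toSecond i′) rows₀₁-equal))

det-expand-row : ∀ {n} (k : Fin (suc n)) (A : Mat (suc n) (suc n)) →
  sgn (toℕ k) * det A ≡ Σᶠ (λ j → sgn (toℕ j) * (A k j * det (minor k j A)))
det-expand-row k A = sym (det-toFront k A)

replaceRow : ∀ {n} → Fin n → Fin n → Fin n → Fin n
replaceRow k i r with r Fin.≟ k
... | yes _ = i
... | no  _ = r

replaceRow-target : ∀ {n} (k i : Fin n) → replaceRow k i k ≡ i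
replaceRow-target k i with k Fin.≟ k
... | yes _  = refl
... | no k≢k = ⊥-elim (k≢k refl)

replaceRow-other : ∀ {n} (k i : Fin n) {r} → r ≢ k → replaceRow k i r ≡ r
replaceRow-other k i {r} r≢k with r Fin.≟ k
... | yes r≡k = ⊥-elim (r≢k r≡k)
... | no  _   = refl

replaceRow-self : ∀ {n} (k r : Fin n) → replaceRow k k r ≡ r
replaceRow-self k r with r Fin.≟ k
... | yes r≡k = sym r≡k
... | no  _   = refl

adj : ∀ {n} → Mat (suc n) (suc n) → Mat (suc n) (suc n)
adj A j k = sgn (toℕ k) * (sgn (toℕ j) * det (minor k j A))

-- The sum is the Laplace expansion along row k of A with row k overwritten by row i.
·-adj-replaceRow : ∀ {n} (A : Mat (suc n) (suc n)) (i k : Fin (suc n)) →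
  (A · adj A) i k ≡ det (A ∘ replaceRow k i)
·-adj-replaceRow {n} A i k = begin
  Σᶠ (λ j → A i j * (sgn (toℕ k) * (sgn (toℕ j) * det (minor k j A))))
    ≡⟨ Σᶠ-cong (λ j → rearrange (A i j) (sgn (toℕ k)) (sgn (toℕ j)) (det (minor k j A))) ⟩
  Σᶠ (λ j → sgn (toℕ k) * (sgn (toℕ j) * (A i j * det (minor k j A))))
    ≡⟨ Σᶠ-*ˡ (sgn (toℕ k)) (λ j → sgn (toℕ j) * (A i j * det (minor k j A))) ⟩
  sgn (toℕ k) * Σᶠ (λ j → sgn (toℕ j) * (A i j * det (minor k j A)))
    ≡⟨ cong (sgn (toℕ k) *_) (Σᶠ-cong λ j → cong₂ (λ a d → sgn (toℕ j) * (a * d))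
         (cong (λ t → A t j) (sym (replaceRow-target k i)))
         (det-cong (minor k j A) (minor k j A′) (minor-unchanged j))) ⟩
  sgn (toℕ k) * Σᶠ (λ j → sgn (toℕ j) * (A′ k j * det (minor k j A′)))
    ≡⟨ cong (sgn (toℕ k) *_) (det-expand-row k A′) ⟨
  sgn (toℕ k) * (sgn (toℕ k) * det A′)
    ≡⟨ sgn-involutive (toℕ k) (det A′) ⟩
  det A′ ∎
  where
  A′ : Mat (suc n) (suc n)
  A′ = A ∘ replaceRow k i
  minor-unchanged : ∀ j → minor k j A ≐ minor k j A′
  minor-unchanged j r c = cong (λ t → A t (punchIn j c)) (sym (replaceRow-other k i (FinP.punchInᵢ≢i k r)))
  rearrange : ∀ a b c d → a * (b * (c * d)) ≡ b * (c * (a * d))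
  rearrange = solve-∀

-- Matching on i ≟ k also evaluates Iₘ i k in the goal to 1ℤ or 0ℤ.
·-adj : ∀ {n} (A : Mat (suc n) (suc n)) i k → (A · adj A) i k ≡ det A * Iₘ i k
·-adj A i k with i Fin.≟ k
... | yes refl = begin
  (A · adj A) i i            ≡⟨ ·-adj-replaceRow A i i ⟩
  det (A ∘ replaceRow i i)   ≡⟨ det-cong (A ∘ replaceRow i i) A unchanged ⟩
  det A                      ≡⟨ ℤP.*-identityʳ (det A) ⟨
  det A * 1ℤ                 ∎
  where
  unchanged : A ∘ replaceRow i i ≐ A
  unchanged r c = cong (λ t → A t c) (replaceRow-self i r)
... | no i≢k = begin
  (A · adj A) i k            ≡⟨ ·-adj-replaceRow A i k ⟩
  det (A ∘ replaceRow k i)   ≡⟨ det-equalRows (A ∘ replaceRow k i) (i≢k ∘ sym) rows-equal ⟩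
  0ℤ                         ≡⟨ ℤP.*-zeroʳ (det A) ⟨
  det A * 0ℤ                 ∎
  where
  rows-equal : A (replaceRow k i k) ≗ A (replaceRow k i i)
  rows-equal c = cong (λ t → A t c) (trans (replaceRow-target k i) (sym (replaceRow-other k i i≢k)))

unimodular⇒det²≡1 : ∀ {n} (V : Mat n n) → Unimodular V → det V * det V ≡ 1ℤ
unimodular⇒det²≡1 V (inj₁ det≡1)  = cong₂ _*_ det≡1 det≡1
unimodular⇒det²≡1 V (inj₂ det≡-1) = cong₂ _*_ det≡-1 det≡-1

unimodular⇒rightInverse : ∀ {n} (V : Mat n n) → Unimodular V → ∃ λ W → V · W ≐ Iₘ
unimodular⇒rightInverse {zero}  V _ = (λ ()) , λ ()
unimodular⇒rightInverse {suc n} V u = (λ j k → det V * adj V j k) , λ i k → begin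
  Σᶠ (λ j → V i j * (det V * adj V j k)) ≡⟨ Σᶠ-cong (λ j → rearrange (V i j) (det V) (adj V j k)) ⟩
  Σᶠ (λ j → det V * (V i j * adj V j k)) ≡⟨ Σᶠ-*ˡ (det V) (λ j → V i j * adj V j k) ⟩
  det V * (V · adj V) i k               ≡⟨ cong (det V *_) (·-adj V i k) ⟩
  det V * (det V * Iₘ i k)              ≡⟨ ℤP.*-assoc (det V) (det V) (Iₘ i k) ⟨
  det V * det V * Iₘ i k                ≡⟨ cong (_* Iₘ i k) (unimodular⇒det²≡1 V u) ⟩
  1ℤ * Iₘ i k                           ≡⟨ ℤP.*-identityˡ (Iₘ i k) ⟩
  Iₘ i k                                ∎
  where
  rearrange : ∀ a b c → a * (b * c) ≡ b * (a * c)
  rearrange = solve-∀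

unimodular-ᵀ : ∀ {n} (V : Mat n n) → Unimodular V → Unimodular (V ᵀ)
unimodular-ᵀ V (inj₁ det≡1)  = inj₁ (trans (det-ᵀ V) det≡1)
unimodular-ᵀ V (inj₂ det≡-1) = inj₂ (trans (det-ᵀ V) det≡-1)

unimodular⇒leftInverse : ∀ {n} (V : Mat n n) → Unimodular V → ∃ λ W → W · V ≐ Iₘ
unimodular⇒leftInverse V u with unimodular⇒rightInverse (V ᵀ) (unimodular-ᵀ V u)
... | W , Vᵀ·W≐I = W ᵀ , λ i j →
  trans (Σᶠ-cong (λ l → ℤP.*-comm (W l i) (V l j))) (trans (Vᵀ·W≐I j i) (Iₘ-symmetric i j))

-- Congruence modulo a matrix and Ádám isomorphisms

mod-reflexive : ∀ {n} (X : Mat n n) (a b : Vec n) → a ≗ b → a ≡ b [mod X ]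
mod-reflexive X a b a≗b = (λ _ → 0ℤ) , λ i → begin
  a i - b i           ≡⟨ cong (λ t → a i - t) (a≗b i) ⟨
  a i - a i           ≡⟨ ℤP.+-inverseʳ (a i) ⟩
  0ℤ                  ≡⟨ *ᵥ-zeroʳ X i ⟨
  (X *ᵥ (λ _ → 0ℤ)) i ∎

mod-sym : ∀ {n} (X : Mat n n) (a b : Vec n) → a ≡ b [mod X ] → b ≡ a [mod X ]
mod-sym X a b (x , a-b≡Xx) = -_ ∘ x , λ i → begin
  b i - a i           ≡⟨ flip-difference (a i) (b i) ⟩
  - (a i - b i)       ≡⟨ cong -_ (a-b≡Xx i) ⟩
  - (X *ᵥ x) i        ≡⟨ *ᵥ-neg X x i ⟨
  (X *ᵥ (-_ ∘ x)) i   ∎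
  where
  flip-difference : ∀ u v → v - u ≡ - (u - v)
  flip-difference = solve-∀

mod-resp-≐ : ∀ {n} {X Y : Mat n n} → X ≐ Y → ∀ a b → a ≡ b [mod X ] ⇔ a ≡ b [mod Y ]
mod-resp-≐ X≐Y a b = mk⇔
  (λ (x , h) → x , λ i → trans (h i) (*ᵥ-congˡ X≐Y x i))
  (λ (y , h) → y , λ i → trans (h i) (sym (*ᵥ-congˡ X≐Y y i)))

mod-·-rightInvertible : ∀ {n} (X V : Mat n n) → (∃ λ W → V · W ≐ Iₘ) →
  ∀ a b → a ≡ b [mod X · V ] ⇔ a ≡ b [mod X ]
mod-·-rightInvertible X V (W , V·W≐I) a b = mk⇔
  (λ (y , h) → V *ᵥ y , λ i → trans (h i) (·-*ᵥ-assoc X V y i))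
  (λ (x , h) → W *ᵥ x , λ i → trans (h i) (begin
     (X *ᵥ x) i                  ≡⟨ *ᵥ-congʳ X (*ᵥ-cancel V W V·W≐I x) i ⟨
     (X *ᵥ (V *ᵥ (W *ᵥ x))) i    ≡⟨ ·-*ᵥ-assoc X V (W *ᵥ x) i ⟨
     ((X · V) *ᵥ (W *ᵥ x)) i     ∎))

mod-*ᵥ-leftInvertible : ∀ {n} (X U : Mat n n) → (∃ λ L → L · U ≐ Iₘ) →
  ∀ a b → a ≡ b [mod X ] ⇔ (U *ᵥ a) ≡ (U *ᵥ b) [mod U · X ]
mod-*ᵥ-leftInvertible X U (L , L·U≐I) a b = mk⇔
  (λ (x , h) → x , λ i → begin
     (U *ᵥ a) i - (U *ᵥ b) i        ≡⟨ *ᵥ-distrib-- U a b i ⟨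
     (U *ᵥ (λ j → a j - b j)) i     ≡⟨ *ᵥ-congʳ U h i ⟩
     (U *ᵥ (X *ᵥ x)) i              ≡⟨ ·-*ᵥ-assoc U X x i ⟨
     ((U · X) *ᵥ x) i               ∎)
  (λ (y , h) → y , λ i → begin
     a i - b i                          ≡⟨ *ᵥ-cancel L U L·U≐I (λ j → a j - b j) i ⟨
     (L *ᵥ (U *ᵥ (λ j → a j - b j))) i  ≡⟨ *ᵥ-congʳ L (λ k → trans (*ᵥ-distrib-- U a b k) (h k)) i ⟩
     (L *ᵥ ((U · X) *ᵥ y)) i            ≡⟨ *ᵥ-congʳ L (·-*ᵥ-assoc U X y) i ⟩
     (L *ᵥ (U *ᵥ (X *ᵥ y))) i           ≡⟨ *ᵥ-cancel L U L·U≐I (X *ᵥ y) i ⟩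
     (X *ᵥ y) i                         ∎)

AdamIsomorphic-id : ∀ {n} {X Y : Mat n n} (A : Vec n → Set) →
  (∀ a b → a ≡ b [mod X ] ⇔ a ≡ b [mod Y ]) → AdamIsomorphic X A Y A
AdamIsomorphic-id {Y = Y} A X≈Y = record
  { ψ          = λ a → a
  ; well-def   = λ a b → Equivalence.to (X≈Y a b)
  ; additive   = λ a b → mod-reflexive Y (a +ᵥ b) (a +ᵥ b) (λ _ → refl)
  ; injective  = λ a b → Equivalence.from (X≈Y a b)
  ; surjective = λ b → b , mod-reflexive Y b b (λ _ → refl)
  ; image⊆     = λ _ Aa → Aa
  ; image⊇     = λ b Ab → b , Ab , mod-reflexive Y b b (λ _ → refl)
  }

AdamIsomorphic-linear : ∀ {n n′} {X : Mat n n} {Y : Mat n′ n′} (A : Vec n → Set) (P : Mat n′ n) →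
  (∀ a b → a ≡ b [mod X ] ⇔ (P *ᵥ a) ≡ (P *ᵥ b) [mod Y ]) →
  (∀ b → ∃ λ a → (P *ᵥ a) ≡ b [mod Y ]) →
  AdamIsomorphic X A Y (λ b → ∃ λ a → A a × b ≡ (P *ᵥ a) [mod Y ])
AdamIsomorphic-linear {Y = Y} A P X≈Y onto = record
  { ψ          = P *ᵥ_
  ; well-def   = λ a b → Equivalence.to (X≈Y a b)
  ; additive   = λ a b → mod-reflexive Y (P *ᵥ (a +ᵥ b)) ((P *ᵥ a) +ᵥ (P *ᵥ b)) (*ᵥ-distrib-+ P a b)
  ; injective  = λ a b → Equivalence.from (X≈Y a b)
  ; surjective = onto
  ; image⊆     = λ a Aa → a , Aa , mod-reflexive Y (P *ᵥ a) (P *ᵥ a) (λ _ → refl)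
  ; image⊇     = λ { b (a , Aa , b≡Pa) → a , Aa , mod-sym Y b (P *ᵥ a) b≡Pa }
  }

-- Reduction to the Smith normal form

DivisorChain : ∀ {n} → (Fin n → ℕ) → Set
DivisorChain {n} s = ∀ (i j : Fin n) → toℕ j ≡ suc (toℕ i) → s i ∣ s j

DivisorChain-tail : ∀ {n} {s : Fin (suc n) → ℕ} → DivisorChain s → DivisorChain (s ∘ suc)
DivisorChain-tail chain i j j≡1+i = chain (suc i) (suc j) (cong suc j≡1+i)

DivisorChain-≢1 : ∀ {n} (s : Fin (suc n) → ℕ) → DivisorChain s → s zero ≢ 1 → ∀ j → s j ≢ 1
DivisorChain-≢1 s           chain s₀≢1 zero = s₀≢1
DivisorChain-≢1 {suc n} s chain s₀≢1 (suc j) =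
  DivisorChain-≢1 (s ∘ suc) (DivisorChain-tail chain)
    (λ s₁≡1 → s₀≢1 (∣1⇒≡1 (subst (s zero ∣_) s₁≡1 (chain zero (suc zero) refl)))) j

countNon1-all : ∀ {n} (s : Fin n → ℕ) → (∀ j → s j ≢ 1) → countNon1 s ≡ n
countNon1-all {zero}  s _ = refl
countNon1-all {suc n} s s≢1 with s zero ℕ.≟ 1
... | yes s₀≡1 = ⊥-elim (s≢1 zero s₀≡1)
... | no  _    = cong suc (countNon1-all (s ∘ suc) (s≢1 ∘ suc))

DivisorChain-leadingOnes : ∀ {n} (s : Fin n → ℕ) → DivisorChain s → ∀ j → toℕ j < n ∸ countNon1 s → s j ≡ 1
DivisorChain-leadingOnes {suc n} s chain j j<n-r with s zero ℕ.≟ 1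
DivisorChain-leadingOnes {suc n} s chain zero    _     | yes s₀≡1 = s₀≡1
DivisorChain-leadingOnes {suc n} s chain (suc j) j<n-r | yes _    =
  DivisorChain-leadingOnes (s ∘ suc) (DivisorChain-tail chain) j
    (ℕ.s<s⁻¹ (subst (suc (toℕ j) <_) (ℕP.+-∸-assoc 1 (countNon1≤ (s ∘ suc))) j<n-r))
... | no s₀≢1 = ⊥-elim (ℕP.n≮0 (subst (toℕ j <_) no-ones j<n-r))
  where
  no-ones : n ∸ countNon1 (s ∘ suc) ≡ 0
  no-ones = trans (cong (n ∸_) (countNon1-all (s ∘ suc) (DivisorChain-≢1 s chain s₀≢1 ∘ suc))) (ℕP.n∸n≡0 n)

module _ {n} (s : Fin n → ℕ) where

  private
    r : ℕ
    r = countNon1 s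
    L : Fin r → Fin n
    L = lastIdx (countNon1≤ s)
    n-r+r≡n : n ∸ r ℕ.+ r ≡ n
    n-r+r≡n = ℕP.m∸n+n≡m (countNon1≤ s)

  splitLast : Fin n → Fin (n ∸ r) ⊎ Fin r
  splitLast j = splitAt (n ∸ r) (cast (sym n-r+r≡n) j)

  splitLast-lastIdx : ∀ i → splitLast (L i) ≡ inj₂ i
  splitLast-lastIdx i = begin
    splitAt (n ∸ r) (cast (sym n-r+r≡n) (cast n-r+r≡n ((n ∸ r) ↑ʳ i)))
      ≡⟨ cong (splitAt (n ∸ r)) (FinP.cast-involutive (sym n-r+r≡n) n-r+r≡n ((n ∸ r) ↑ʳ i)) ⟩
    splitAt (n ∸ r) ((n ∸ r) ↑ʳ i)
      ≡⟨ FinP.splitAt-↑ʳ (n ∸ r) r i ⟩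
    inj₂ i ∎

  splitLast≡inj₂ : ∀ {j i} → splitLast j ≡ inj₂ i → L i ≡ j
  splitLast≡inj₂ {j} {i} split≡i = begin
    cast n-r+r≡n (join (n ∸ r) r (inj₂ i))
      ≡⟨ cong (cast n-r+r≡n ∘ join (n ∸ r) r) split≡i ⟨
    cast n-r+r≡n (join (n ∸ r) r (splitLast j))
      ≡⟨ cong (cast n-r+r≡n) (FinP.join-splitAt (n ∸ r) r (cast (sym n-r+r≡n) j)) ⟩
    cast n-r+r≡n (cast (sym n-r+r≡n) j)
      ≡⟨ FinP.cast-involutive n-r+r≡n (sym n-r+r≡n) j ⟩
    j ∎

  splitLast≡inj₁ : ∀ {j k} → splitLast j ≡ inj₁ k → toℕ j < n ∸ r
  splitLast≡inj₁ {j} {k} split≡k = subst (_< n ∸ r) toℕk≡toℕj (FinP.toℕ<n k)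
    where
    toℕk≡toℕj : toℕ k ≡ toℕ j
    toℕk≡toℕj = begin
      toℕ k                                      ≡⟨ FinP.toℕ-↑ˡ k r ⟨
      toℕ (join (n ∸ r) r (inj₁ k))              ≡⟨ cong (toℕ ∘ join (n ∸ r) r) split≡k ⟨
      toℕ (join (n ∸ r) r (splitLast j))         ≡⟨ cong toℕ (FinP.join-splitAt (n ∸ r) r (cast (sym n-r+r≡n) j)) ⟩
      toℕ (cast (sym n-r+r≡n) j)                 ≡⟨ FinP.toℕ-cast (sym n-r+r≡n) j ⟩
      toℕ j                                      ∎

  mod-diag⇔mod-S′ : DivisorChain s → ∀ c d → c ≡ d [mod diag s ] ⇔ (c ∘ L) ≡ (d ∘ L) [mod S′ s ]
  mod-diag⇔mod-S′ chain c d = mk⇔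
    (λ (x , h) → x ∘ L , λ i → begin
      c (L i) - d (L i)      ≡⟨ h (L i) ⟩
      (diag s *ᵥ x) (L i)    ≡⟨ diag-*ᵥ s x (L i) ⟩
      + s (L i) * x (L i)    ≡⟨ diag-*ᵥ (s ∘ L) (x ∘ L) i ⟨
      (S′ s *ᵥ (x ∘ L)) i    ∎)
    (λ (y , h) → quotient y , λ j → trans (difference≡s*quotient y h j) (sym (diag-*ᵥ s (quotient y) j)))
    where
    quotientAt : Vec r → ∀ j → Fin (n ∸ r) ⊎ Fin r → ℤ
    quotientAt y j (inj₁ _) = c j - d j
    quotientAt y j (inj₂ i) = y i
    quotient : Vec r → Vec n
    quotient y j = quotientAt y j (splitLast j)
    -- On the leading indices s j = 1, so any difference is a multiple of s j.
    difference≡s*quotient : ∀ y → (∀ i → c (L i) - d (L i) ≡ (S′ s *ᵥ y) i) →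
      ∀ j → c j - d j ≡ + s j * quotient y j
    difference≡s*quotient y h j with splitLast j in split≡
    ... | inj₁ _ = sym (trans
      (cong (λ t → + t * (c j - d j)) (DivisorChain-leadingOnes s chain j (splitLast≡inj₁ split≡)))
      (ℤP.*-identityˡ (c j - d j)))
    ... | inj₂ i = subst (λ t → c t - d t ≡ + s t * y i) (splitLast≡inj₂ split≡)
      (trans (h i) (diag-*ᵥ (s ∘ L) y i))

  U′-onto : (U : Mat n n) → (∃ λ W → U · W ≐ Iₘ) → ∀ b → ∃ λ a → (U′ s U *ᵥ a) ≡ b [mod S′ s ]
  U′-onto U (W , U·W≐I) b = W *ᵥ padded , mod-reflexive (S′ s) (U′ s U *ᵥ (W *ᵥ padded)) b λ i → begin
    (U *ᵥ (W *ᵥ padded)) (L i) ≡⟨ *ᵥ-cancel U W U·W≐I padded (L i) ⟩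
    padded (L i)               ≡⟨ cong [ (λ _ → 0ℤ) , b ]′ (splitLast-lastIdx i) ⟩
    b i                        ∎
    where
    padded : Vec n
    padded j = [ (λ _ → 0ℤ) , b ]′ (splitLast j)

mod-·-unimodular : ∀ {n} (M V : Mat n n) {H : Mat n n} → Unimodular V → M · V ≐ H →
  ∀ a b → a ≡ b [mod M ] ⇔ a ≡ b [mod H ]
mod-·-unimodular M V {H} unimodV M·V≐H a b = ⇔-begin
  a ≡ b [mod M ]      ≈⟨ mod-·-rightInvertible M V (unimodular⇒rightInverse V unimodV) a b ⟨
  a ≡ b [mod M · V ]  ≈⟨ mod-resp-≐ M·V≐H a b ⟩
  a ≡ b [mod H ]      ⇔-∎
  where open SetoidReasoning (⇔-setoid 0ℓ) renaming (begin_ to ⇔-begin_; _∎ to _⇔-∎)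

IsSmithNF-congruence : ∀ {n} (M U V′ : Mat n n) {s : Fin n → ℕ} → IsSmithNF M U V′ s →
  ∀ a b → a ≡ b [mod M ] ⇔ (U′ s U *ᵥ a) ≡ (U′ s U *ᵥ b) [mod S′ s ]
IsSmithNF-congruence M U V′ {s} (unimodU , unimodV′ , U·M·V′≐S , _ , chain) a b = ⇔-begin
  a ≡ b [mod M ]
    ≈⟨ mod-*ᵥ-leftInvertible M U (unimodular⇒leftInverse U unimodU) a b ⟩
  (U *ᵥ a) ≡ (U *ᵥ b) [mod U · M ]
    ≈⟨ mod-·-rightInvertible (U · M) V′ (unimodular⇒rightInverse V′ unimodV′) (U *ᵥ a) (U *ᵥ b) ⟨
  (U *ᵥ a) ≡ (U *ᵥ b) [mod (U · M) · V′ ]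
    ≈⟨ mod-resp-≐ U·M·V′≐S (U *ᵥ a) (U *ᵥ b) ⟩
  (U *ᵥ a) ≡ (U *ᵥ b) [mod diag s ]
    ≈⟨ mod-diag⇔mod-S′ s chain (U *ᵥ a) (U *ᵥ b) ⟩
  (U′ s U *ᵥ a) ≡ (U′ s U *ᵥ b) [mod S′ s ] ⇔-∎
  where open SetoidReasoning (⇔-setoid 0ℓ) renaming (begin_ to ⇔-begin_; _∎ to _⇔-∎)

theorem3p2 : (n : ℕ) (M : Mat n n) (A : Vec n → Set)
  → Nonsingular M
  → IsSubsetMod M A
  → (H V : Mat n n) → Unimodular V → (∀ i j → (M · V) i j ≡ H i j) → IsHermiteNF H
  → (U V′ : Mat n n) (s : Fin n → ℕ) → IsSmithNF M U V′ s
  → AdamIsomorphic M A H A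
    × AdamIsomorphic M A (S′ s) (φ s U A)
    × AdamIsomorphic H A (S′ s) (φ s U A)
theorem3p2 n M A _ _ H V unimodV M·V≐H _ U V′ s smith@(unimodU , _) =
    AdamIsomorphic-id A M≈H
  , AdamIsomorphic-linear A (U′ s U) M≈S′ onto
  , AdamIsomorphic-linear A (U′ s U) (λ a b → M≈S′ a b ⇔-∘ ⇔-sym (M≈H a b)) onto
  where
  M≈H : ∀ a b → a ≡ b [mod M ] ⇔ a ≡ b [mod H ]
  M≈H = mod-·-unimodular M V unimodV M·V≐H
  M≈S′ : ∀ a b → a ≡ b [mod M ] ⇔ (U′ s U *ᵥ a) ≡ (U′ s U *ᵥ b) [mod S′ s ]
  M≈S′ = IsSmithNF-congruence M U V′ smith
  onto : ∀ b → ∃ λ a → (U′ s U *ᵥ a) ≡ b [mod S′ s ]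
  onto = U′-onto s U (unimodular⇒rightInverse U unimodU)
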